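{- Let $A$ be an $m \times n$ $0,1$-matrix with non-increasing row sums $(r_1,\dots,r_m)$ and non-increasing column sums $(c_1,\dots,c_n)=(x_1,\dots,x_1,x_2,\dots,x_2,\dots,x_k,\dots,x_k)$ with $x_1>x_2>\dots>x_k$, and let $F$ be its Ferrers matrix. For $i=1,\dots,k$ let $\Sigma_i$ be the set of permutations $\sigma_i$ of $\{1,\dots,n\}$ that fix every index $j$ with $c_j\neq x_i$ (so they only permute the columns with column sum $x_i$). Then the isomorphic discrepancy of $A$ satisfies $$Id(A)=\sum_{i=1}^k\left(\min_{\sigma_i\in\Sigma_i}\sum_{j:\,c_j=x_i}(F_j-A^{\sigma_i}_j)\right).$$
   Context: The Ferrers matrix $F$ of $A$ is the $m\times n$ $0,1$-matrix whose $i$-th row consists of $r_i$ ones followed by $n-r_i$ zeros. A shift is the movement of a $1$ in some row to a position further to the left in the same row that contains a $0$. For a $0,1$-matrix $B$ with non-increasing row and column sums, $disc(B)$ is the minimum number of shifts needed to transform $B$ into its Ferrers matrix. $I_A$ denotes the set of all matrices obtained from $A$ by permuting rows having equal row sums and permuting columns having equal column sums; the isomorphic discrepancy is $Id(A):=\min_{B\in I_A} disc(B)$. For a permutation $\sigma$ of the column indices, $A^{\sigma}$ denotes the matrix obtained from $A$ by permuting its columns according to $\sigma$ (column $j'$ of $A$ becomes column $\sigma(j')$ of $A^\sigma$), and $A^\sigma_j$ is its $j$-th column. For columns, $(F_j-A^{\sigma}_j):=\sum_{l=1}^m (F_{l,j}-A^{\sigma}_{l,j})^+$ with $x^+=\max(x,0)$.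 -}

module Defs where

open import Data.Nat using (ℕ; zero; suc; _+_; _∸_; _≤_; _<_)
open import Data.Bool using (Bool; true; false; if_then_else_)
open import Data.Fin using (Fin; toℕ) renaming (_≤_ to _≤ᶠ_; _<_ to _<ᶠ_)
import Data.Fin as F
open import Data.Fin.Permutation using (Permutation′; _⟨$⟩ʳ_; _⟨$⟩ˡ_)
open import Data.Product using (Σ; _×_; ∃)
open import Relation.Binary.PropositionalEquality using (_≡_)
open import Relation.Nullary using (¬_; does)
open import Data.Nat using (_<?_; _≟_)

Mat : ℕ → ℕ → Set
Mat m n = Fin m → Fin n → Bool

val : Bool → ℕ
val true  = 1
val false = 0

∑ : ∀ {n} → (Fin n → ℕ) → ℕ
∑ {zero}  f = 0
∑ {suc n} f = f F.zero + ∑ (λ i → f (F.suc i))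

rowSum : ∀ {m n} → Mat m n → Fin m → ℕ
rowSum A i = ∑ (λ j → val (A i j))

colSum : ∀ {m n} → Mat m n → Fin n → ℕ
colSum A j = ∑ (λ i → val (A i j))

NonIncreasing : ∀ {n} → (Fin n → ℕ) → Set
NonIncreasing {n} v = ∀ (i j : Fin n) → i ≤ᶠ j → v j ≤ v i

Ferrers : ∀ {m n} → Mat m n → Mat m n
Ferrers A i j = does (toℕ j <? rowSum A i)

_≐_ : ∀ {m n} → Mat m n → Mat m n → Set
B ≐ C = ∀ i j → B i j ≡ C i j

Shift : ∀ {m n} → Mat m n → Mat m n → Set
Shift {m} {n} B B' =
  Σ (Fin m) λ i → Σ (Fin n) λ j → Σ (Fin n) λ j' →
    (j' <ᶠ j) × (B i j ≡ true) × (B i j' ≡ false) ×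
    (B' i j ≡ false) × (B' i j' ≡ true) ×
    (∀ a b → ¬ (a ≡ i × b ≡ j) → ¬ (a ≡ i × b ≡ j') → B' a b ≡ B a b)

Shifts : ∀ {m n} → ℕ → Mat m n → Mat m n → Set
Shifts zero    B C = B ≐ C
Shifts (suc s) B C = Σ (Mat _ _) λ B' → Shift B B' × Shifts s B' C

IsLeast : (ℕ → Set) → ℕ → Set
IsLeast P d = P d × (∀ d' → P d' → d ≤ d')

DiscIs : ∀ {m n} → Mat m n → ℕ → Set
DiscIs B d = IsLeast (λ s → Shifts s B (Ferrers B)) d

InI : ∀ {m n} → Mat m n → Mat m n → Set
InI {m} {n} A B =
  Σ (Permutation′ m) λ ρ → Σ (Permutation′ n) λ τ →
    (∀ i → rowSum A (ρ ⟨$⟩ʳ i) ≡ rowSum A i) ×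
    (∀ j → colSum A (τ ⟨$⟩ʳ j) ≡ colSum A j) ×
    (∀ i j → B i j ≡ A (ρ ⟨$⟩ʳ i) (τ ⟨$⟩ʳ j))

IdIs : ∀ {m n} → Mat m n → ℕ → Set
IdIs A d = IsLeast (λ e → Σ (Mat _ _) λ B → InI A B × DiscIs B e) d

-- A^σ : column j' of A becomes column σ(j') of A^σ
colPerm : ∀ {m n} → Mat m n → Permutation′ n → Mat m n
colPerm A σ l j = A l (σ ⟨$⟩ˡ j)

colDiff : ∀ {m n} → Mat m n → Mat m n → Fin n → ℕ
colDiff F B j = ∑ (λ l → val (F l j) ∸ val (B l j))

classCost : ∀ {m n} → Mat m n → ℕ → Permutation′ n → ℕ
classCost A x σ =
  ∑ (λ j → if does (colSum A j ≟ x) then colDiff (Ferrers A) (colPerm A σ) j else 0)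

InSigma : ∀ {m n} → Mat m n → ℕ → Permutation′ n → Set
InSigma A x σ = ∀ j → ¬ (colSum A j ≡ x) → σ ⟨$⟩ʳ j ≡ j

-- disc B is the deficit of B: the number of positions where its Ferrers matrix has a 1 and B has a 0.
-- A shift fills at most one such hole, and while a hole remains its row (having the right number
-- of ones) also holds a 1 to the right of the Ferrers shape, which can be shifted into it.
-- For a member of I_A this count depends only on the column permutation, and it splits as a
-- sum over the classes of equal column sum. Column permutations preserving column sums are
-- exactly the independent choices of one permutation per class, so the minimum of the sum
-- is the sum of the classwise minima.
module Submission where

open import Defs
open import Data.Nat using (ℕ; zero; suc; _+_; _∸_; _≤_; _<_; _>_; z≤n; s≤s; _<?_; _≤?_; _≟_)
open import Data.Nat.Properties
open import Data.Bool using (Bool; true; false; if_then_else_)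
open import Data.Fin using (Fin; toℕ) renaming (zero to fzero; suc to fsuc; _<_ to _<ᶠ_)
open import Data.Fin.Properties using (¬∀⟶∃¬)
  renaming (_≟_ to _≟ᶠ_; suc-injective to fsuc-injective; <⇒≢ to <⇒≢ᶠ; <-cmp to <-cmpᶠ)
open import Data.Fin.Permutation using (Permutation′; _⟨$⟩ʳ_; _⟨$⟩ˡ_; inverseˡ; inverseʳ; permutation; flip)
import Data.Fin.Permutation as Perm
open import Data.Sum using (inj₁; inj₂)
open import Data.Product using (Σ; ∃; ∃₂; _×_; _,_; proj₁; proj₂)
open import Data.Vec.Functional using (updateAt)
open import Data.Vec.Functional.Properties using (updateAt-updates; updateAt-minimal)
open import Function using (_∘_; const)
open import Relation.Binary.PropositionalEquality
open import Relation.Nullary using (¬_; Dec; does; yes; no; contradiction)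
open import Relation.Nullary.Decidable using (dec-true; dec-false; decidable-stable; does-⇔)
open import Relation.Binary.Definitions using (tri<; tri≈; tri>)
open import Function.Bundles using (_⇔_; mk⇔; Equivalence)
import Algebra.Properties.CommutativeMonoid.Sum as CommutativeMonoidSum

open module ℕ-Sum = CommutativeMonoidSum +-0-commutativeMonoid using (sum)

-- Finite sums

∑≗sum : ∀ {n} (f : Fin n → ℕ) → ∑ f ≡ sum f
∑≗sum {zero}  f = refl
∑≗sum {suc n} f = cong (f fzero +_) (∑≗sum (f ∘ fsuc))

∑-cong : ∀ {n} {f g : Fin n → ℕ} → (∀ i → f i ≡ g i) → ∑ f ≡ ∑ g
∑-cong {zero}  f≗g = refl
∑-cong {suc n} f≗g = cong₂ _+_ (f≗g fzero) (∑-cong (f≗g ∘ fsuc))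

∑-mono-≤ : ∀ {n} {f g : Fin n → ℕ} → (∀ i → f i ≤ g i) → ∑ f ≤ ∑ g
∑-mono-≤ {zero}  f≤g = z≤n
∑-mono-≤ {suc n} f≤g = +-mono-≤ (f≤g fzero) (∑-mono-≤ (f≤g ∘ fsuc))

∑-mono-< : ∀ {n} {f g : Fin n → ℕ} → (∀ i → f i ≤ g i) → ∀ p → f p < g p → ∑ f < ∑ g
∑-mono-< f≤g fzero    fp<gp = +-mono-<-≤ fp<gp (∑-mono-≤ (f≤g ∘ fsuc))
∑-mono-< f≤g (fsuc p) fp<gp = +-mono-≤-< (f≤g fzero) (∑-mono-< (f≤g ∘ fsuc) p fp<gp)

∑-comm : ∀ {m n} (f : Fin m → Fin n → ℕ) → ∑ (λ i → ∑ (f i)) ≡ ∑ (λ j → ∑ (λ i → f i j))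
∑-comm f = begin
  ∑ (λ i → ∑ (f i))            ≡⟨ ∑-cong (λ i → ∑≗sum (f i)) ⟩
  ∑ (λ i → sum (f i))          ≡⟨ ∑≗sum (λ i → sum (f i)) ⟩
  sum (λ i → sum (f i))        ≡⟨ ℕ-Sum.∑-comm f ⟩
  sum (λ j → sum (λ i → f i j)) ≡⟨ sym (∑≗sum (λ j → sum (λ i → f i j))) ⟩
  ∑ (λ j → sum (λ i → f i j))  ≡⟨ ∑-cong (λ j → sym (∑≗sum (λ i → f i j))) ⟩
  ∑ (λ j → ∑ (λ i → f i j))    ∎
  where open ≡-Reasoning

∑-permute : ∀ {n} (f : Fin n → ℕ) (π : Permutation′ n) → ∑ (f ∘ (π ⟨$⟩ʳ_)) ≡ ∑ f
∑-permute f π = begin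
  ∑ (f ∘ (π ⟨$⟩ʳ_))   ≡⟨ ∑≗sum (f ∘ (π ⟨$⟩ʳ_)) ⟩
  sum (f ∘ (π ⟨$⟩ʳ_)) ≡⟨ sym (ℕ-Sum.sum-permute f π) ⟩
  sum f              ≡⟨ sym (∑≗sum f) ⟩
  ∑ f                ∎
  where open ≡-Reasoning

∑-zero : ∀ {n} → ∑ {n} (const 0) ≡ 0
∑-zero {zero}  = refl
∑-zero {suc n} = ∑-zero {n}

∑-indicator : ∀ {n} (p : Fin n) y → ∑ (λ i → if does (p ≟ᶠ i) then y else 0) ≡ y
∑-indicator {suc n} fzero    y = trans (cong (y +_) (∑-zero {n})) (+-identityʳ y)
∑-indicator {suc n} (fsuc p) y = ∑-indicator p y

∑-positive : ∀ {n} (f : Fin n → ℕ) → 0 < ∑ f → ∃ λ i → 0 < f i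
∑-positive {suc n} f 0<∑f with f fzero in f0≡
... | suc _ = fzero , subst (0 <_) (sym f0≡) (s≤s z≤n)
... | zero  = let i , 0<fi = ∑-positive (f ∘ fsuc) 0<∑f in fsuc i , 0<fi

∑≡0⇒≡0 : ∀ {n} (f : Fin n → ℕ) → ∑ f ≡ 0 → ∀ i → f i ≡ 0
∑≡0⇒≡0 f ∑f≡0 fzero    = m+n≡0⇒m≡0 (f fzero) ∑f≡0
∑≡0⇒≡0 f ∑f≡0 (fsuc i) = ∑≡0⇒≡0 (f ∘ fsuc) (m+n≡0⇒n≡0 (f fzero) ∑f≡0) i

∑-mono-≤-equality : ∀ {n} {f g : Fin n → ℕ} → (∀ i → f i ≤ g i) → ∑ f ≡ ∑ g → ∀ i → f i ≡ g i
∑-mono-≤-equality f≤g ∑f≡∑g i with m≤n⇒m<n∨m≡n (f≤g i)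
... | inj₁ fi<gi = contradiction ∑f≡∑g (<⇒≢ (∑-mono-< f≤g i fi<gi))
... | inj₂ fi≡gi = fi≡gi

∑-except-≤ : ∀ {n} {f g : Fin n → ℕ} p → (∀ i → i ≢ p → f i ≤ g i) → f p ≤ suc (g p) → ∑ f ≤ suc (∑ g)
∑-except-≤ fzero f≤g fp≤ = +-mono-≤ fp≤ (∑-mono-≤ (λ i → f≤g (fsuc i) λ ()))
∑-except-≤ {f = f} {g} (fsuc p) f≤g fp≤ = begin
  f fzero + ∑ (f ∘ fsuc)        ≤⟨ +-mono-≤ (f≤g fzero λ ())
                                             (∑-except-≤ p (λ i i≢p → f≤g (fsuc i) (i≢p ∘ fsuc-injective)) fp≤) ⟩
  g fzero + suc (∑ (g ∘ fsuc))  ≡⟨ +-suc (g fzero) _ ⟩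
  suc (g fzero + ∑ (g ∘ fsuc))  ∎
  where open ≤-Reasoning

∑-except-≡ : ∀ {n} {f g : Fin n → ℕ} p → (∀ i → i ≢ p → f i ≡ g i) → f p ≡ suc (g p) → ∑ f ≡ suc (∑ g)
∑-except-≡ fzero    f≡g fp≡ = cong₂ _+_ fp≡ (∑-cong (λ i → f≡g (fsuc i) λ ()))
∑-except-≡ {g = g} (fsuc p) f≡g fp≡ =
  trans (cong₂ _+_ (f≡g fzero λ ()) (∑-except-≡ p (λ i i≢p → f≡g (fsuc i) (i≢p ∘ fsuc-injective)) fp≡))
        (+-suc (g fzero) _)

-- Discrepancy

val≤1 : ∀ f → val f ≤ 1
val≤1 true  = s≤s z≤n
val≤1 false = z≤n

val-injective : ∀ {f g} → val f ≡ val g → f ≡ g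
val-injective {true}  {true}  _ = refl
val-injective {false} {false} _ = refl

val∸1≡0 : ∀ f → val f ∸ 1 ≡ 0
val∸1≡0 true  = refl
val∸1≡0 false = refl

val∸val-positive : ∀ f g → 0 < val f ∸ val g → f ≡ true × g ≡ false
val∸val-positive true  false _  = refl , refl
val∸val-positive true  true  ()
val∸val-positive false true  ()
val∸val-positive false false ()

val≰val : ∀ f g → ¬ val g ≤ val f → f ≡ false × g ≡ true
val≰val false true  _   = refl , refl
val≰val true  true  g≰f = contradiction ≤-refl g≰f
val≰val false false g≰f = contradiction ≤-refl g≰f
val≰val true  false g≰f = contradiction z≤n g≰f

rowSum≤ : ∀ {n} (row : Fin n → Bool) → ∑ (val ∘ row) ≤ n
rowSum≤ {zero}  row = z≤n
rowSum≤ {suc n} row = +-mono-≤ (val≤1 (row fzero)) (rowSum≤ (row ∘ fsuc))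

∑-val-<? : ∀ {n} r → r ≤ n → ∑ {n} (λ b → val (does (toℕ b <? r))) ≡ r
∑-val-<? {zero}  zero    z≤n       = refl
∑-val-<? {suc n} zero    _         = ∑-zero {n}
∑-val-<? {suc n} (suc r) (s≤s r≤n) = cong suc (∑-val-<? r r≤n)

rowSum-Ferrers : ∀ {m n} (C : Mat m n) a → rowSum (Ferrers C) a ≡ rowSum C a
rowSum-Ferrers C a = ∑-val-<? (rowSum C a) (rowSum≤ (C a))

Ferrers-true<false : ∀ {m n} (C : Mat m n) {a b b'} → Ferrers C a b' ≡ true → Ferrers C a b ≡ false → b' <ᶠ b
Ferrers-true<false C {a} {b} {b'} F≡1 F≡0 = <-≤-trans b'<r (≮⇒≥ b≮r)
  where
    b'<r : toℕ b' < rowSum C a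
    b'<r = decidable-stable (toℕ b' <? rowSum C a)
             λ b'≮r → contradiction (trans (sym F≡1) (dec-false (toℕ b' <? rowSum C a) b'≮r)) λ ()
    b≮r : ¬ toℕ b < rowSum C a
    b≮r b<r = contradiction (trans (sym (dec-true (toℕ b <? rowSum C a) b<r)) F≡0) λ ()

equalRowSums⇒surplus : ∀ {n} (f g : Fin n → Bool) → ∑ (val ∘ f) ≡ ∑ (val ∘ g) →
                        ∀ p → f p ≡ true → g p ≡ false → ∃ λ q → f q ≡ false × g q ≡ true
equalRowSums⇒surplus {n} f g ∑f≡∑g p fp≡1 gp≡0
  with ¬∀⟶∃¬ n (λ q → val (g q) ≤ val (f q)) (λ q → val (g q) ≤? val (f q)) g≤f-absurd
  where
    g≤f-absurd : ¬ (∀ q → val (g q) ≤ val (f q))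
    g≤f-absurd g≤f = <⇒≢ (∑-mono-< g≤f p gp<fp) (sym ∑f≡∑g)
      where gp<fp = subst₂ (λ u v → val u < val v) (sym gp≡0) (sym fp≡1) (s≤s z≤n)
... | q , g≰f = q , val≰val (f q) (g q) g≰f

rowDeficit : ∀ {m n} → Mat m n → Mat m n → Fin m → ℕ
rowDeficit F B a = ∑ λ b → val (F a b) ∸ val (B a b)

deficit : ∀ {m n} → Mat m n → Mat m n → ℕ
deficit F B = ∑ (rowDeficit F B)

≐⇒deficit≡0 : ∀ {m n} {F B : Mat m n} → B ≐ F → deficit F B ≡ 0
≐⇒deficit≡0 {m} {n} {F} {B} B≐F = trans (∑-cong λ a → trans (∑-cong (cellZero a)) (∑-zero {n})) (∑-zero {m})
  where
    cellZero : ∀ a b → val (F a b) ∸ val (B a b) ≡ 0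
    cellZero a b = trans (cong (λ e → val (F a b) ∸ val e) (B≐F a b)) (n∸n≡0 (val (F a b)))

deficit≡0⇒≐ : ∀ {m n} {F B : Mat m n} → (∀ a → rowSum F a ≡ rowSum B a) → deficit F B ≡ 0 → B ≐ F
deficit≡0⇒≐ {F = F} {B} sameRowSums deficit≡0 a b =
  sym (val-injective (∑-mono-≤-equality F≤B (sameRowSums a) b))
  where
    F≤B : ∀ b → val (F a b) ≤ val (B a b)
    F≤B b = m∸n≡0⇒m≤n (∑≡0⇒≡0 _ (∑≡0⇒≡0 _ deficit≡0 a) b)

deficit-positive⇒hole : ∀ {m n} (F B : Mat m n) → 0 < deficit F B →
                        ∃₂ λ a b → F a b ≡ true × B a b ≡ false
deficit-positive⇒hole F B 0<deficit =
  let a , 0<row  = ∑-positive (rowDeficit F B) 0<deficit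
      b , 0<cell = ∑-positive (λ b → val (F a b) ∸ val (B a b)) 0<row
  in a , b , val∸val-positive (F a b) (B a b) 0<cell

shift-deficit : ∀ {m n} (F : Mat m n) {B B'} → Shift B B' → deficit F B ≤ suc (deficit F B')
shift-deficit F {B} {B'} (i , j , j' , _ , Bij≡1 , Bij'≡0 , _ , _ , unchanged) =
  ∑-except-≤ i otherRow (∑-except-≤ j' otherCell holeCell)
  where
    otherRow : ∀ a → a ≢ i → rowDeficit F B a ≤ rowDeficit F B' a
    otherRow a a≢i = ≤-reflexive (∑-cong λ b →
      cong (λ e → val (F a b) ∸ val e) (sym (unchanged a b (a≢i ∘ proj₁) (a≢i ∘ proj₁))))
    otherCell : ∀ b → b ≢ j' → val (F i b) ∸ val (B i b) ≤ val (F i b) ∸ val (B' i b)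
    otherCell b b≢j' with b ≟ᶠ j
    ... | yes refl rewrite Bij≡1 = subst (_≤ val (F i b) ∸ val (B' i b)) (sym (val∸1≡0 (F i b))) z≤n
    ... | no b≢j = ≤-reflexive (cong (λ e → val (F i b) ∸ val e)
                                     (sym (unchanged i b (b≢j ∘ proj₂) (b≢j' ∘ proj₂))))
    holeCell : val (F i j') ∸ val (B i j') ≤ suc (val (F i j') ∸ val (B' i j'))
    holeCell rewrite Bij'≡0 = ≤-trans (val≤1 (F i j')) (s≤s z≤n)

shifts-deficit : ∀ {m n} s {F B : Mat m n} → Shifts s B F → deficit F B ≤ s
shifts-deficit zero    B≐F                 = ≤-reflexive (≐⇒deficit≡0 B≐F)
shifts-deficit (suc s) {F} (_ , shift , shifts) = ≤-trans (shift-deficit F shift) (s≤s (shifts-deficit s shifts))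

moveRow : ∀ {n} → (Fin n → Bool) → Fin n → Fin n → Fin n → Bool
moveRow row b b' = updateAt (updateAt row b' (const true)) b (const false)

moveRow-sum : ∀ {n} (row : Fin n → Bool) {b b'} → b ≢ b' → row b ≡ true → row b' ≡ false →
              ∑ (val ∘ moveRow row b b') ≡ ∑ (val ∘ row)
moveRow-sum row {b} {b'} b≢b' rowb≡1 rowb'≡0 = suc-injective (trans (sym emptied) filledSum)
  where
    filled = updateAt row b' (const true)
    filledSum : ∑ (val ∘ filled) ≡ suc (∑ (val ∘ row))
    filledSum = ∑-except-≡ b' (λ c c≢b' → cong val (updateAt-minimal c b' row c≢b'))
                  (trans (cong val (updateAt-updates b' row)) (cong (suc ∘ val) (sym rowb'≡0)))
    emptied : ∑ (val ∘ filled) ≡ suc (∑ (val ∘ moveRow row b b'))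
    emptied = ∑-except-≡ b (λ c c≢b → cong val (sym (updateAt-minimal c b filled c≢b)))
                (trans (cong val (trans (updateAt-minimal b b' row b≢b') rowb≡1))
                       (cong (suc ∘ val) (sym (updateAt-updates b filled))))

move : ∀ {m n} → Mat m n → Fin m → Fin n → Fin n → Mat m n
move B a b b' = updateAt B a λ row → moveRow row b b'

module _ {m n} (B : Mat m n) (a : Fin m) (b b' : Fin n) where

  move-row : move B a b b' a ≡ moveRow (B a) b b'
  move-row = updateAt-updates a B

  move-otherRow : ∀ {a'} → a' ≢ a → move B a b b' a' ≡ B a'
  move-otherRow a'≢a = updateAt-minimal _ a B a'≢a

  move-from : move B a b b' a b ≡ false
  move-from = trans (cong (λ row → row b) move-row) (updateAt-updates b _)

  move-to : b' ≢ b → move B a b b' a b' ≡ true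
  move-to b'≢b = trans (cong (λ row → row b') move-row)
                   (trans (updateAt-minimal b' b _ b'≢b) (updateAt-updates b' (B a)))

  move-otherCol : ∀ {c} → c ≢ b → c ≢ b' → move B a b b' a c ≡ B a c
  move-otherCol {c} c≢b c≢b' = trans (cong (λ row → row c) move-row)
                                 (trans (updateAt-minimal c b _ c≢b) (updateAt-minimal c b' (B a) c≢b'))

  move-unchanged : ∀ a' c → ¬ (a' ≡ a × c ≡ b) → ¬ (a' ≡ a × c ≡ b') → move B a b b' a' c ≡ B a' c
  move-unchanged a' c ¬ab ¬ab' with a' ≟ᶠ a
  ... | yes refl = move-otherCol (λ c≡b → ¬ab (refl , c≡b)) (λ c≡b' → ¬ab' (refl , c≡b'))
  ... | no a'≢a  = cong (λ row → row c) (move-otherRow a'≢a)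

  move-shift : b' <ᶠ b → B a b ≡ true → B a b' ≡ false → Shift B (move B a b b')
  move-shift b'<b Bab≡1 Bab'≡0 =
    a , b , b' , b'<b , Bab≡1 , Bab'≡0 , move-from , move-to (<⇒≢ᶠ b'<b) , move-unchanged

  move-rowSum : b ≢ b' → B a b ≡ true → B a b' ≡ false → ∀ a' → rowSum (move B a b b') a' ≡ rowSum B a'
  move-rowSum b≢b' Bab≡1 Bab'≡0 a' with a' ≟ᶠ a
  ... | no a'≢a  = cong (λ row → ∑ (val ∘ row)) (move-otherRow a'≢a)
  ... | yes refl = trans (cong (λ row → ∑ (val ∘ row)) move-row) (moveRow-sum (B a) b≢b' Bab≡1 Bab'≡0)

  move-deficit : (F : Mat m n) → F a b ≡ false → F a b' ≡ true → B a b' ≡ false →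
                 deficit F B ≡ suc (deficit F (move B a b b'))
  move-deficit F Fab≡0 Fab'≡1 Bab'≡0 = ∑-except-≡ a otherRow (∑-except-≡ b' otherCell holeCell)
    where
      b'≢b : b' ≢ b
      b'≢b refl = contradiction (trans (sym Fab≡0) Fab'≡1) λ ()
      otherRow : ∀ a' → a' ≢ a → rowDeficit F B a' ≡ rowDeficit F (move B a b b') a'
      otherRow a' a'≢a = ∑-cong λ c →
        cong (λ e → val (F a' c) ∸ val e) (sym (cong (λ row → row c) (move-otherRow a'≢a)))
      otherCell : ∀ c → c ≢ b' → val (F a c) ∸ val (B a c) ≡ val (F a c) ∸ val (move B a b b' a c)
      otherCell c c≢b' with c ≟ᶠ b
      ... | yes refl rewrite Fab≡0 = trans (0∸n≡0 (val (B a c))) (sym (0∸n≡0 (val (move B a b b' a c))))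
      ... | no c≢b = cong (λ e → val (F a c) ∸ val e) (sym (move-otherCol c≢b c≢b'))
      holeCell : val (F a b') ∸ val (B a b') ≡ suc (val (F a b') ∸ val (move B a b b' a b'))
      holeCell rewrite Fab'≡1 | Bab'≡0 | move-to b'≢b = refl

deficit-shifts : ∀ {m n} (C : Mat m n) s (B : Mat m n) → (∀ a → rowSum B a ≡ rowSum C a) →
                 deficit (Ferrers C) B ≡ s → Shifts s B (Ferrers C)
deficit-shifts C zero B sameRowSums deficit≡0 =
  deficit≡0⇒≐ (λ a → trans (rowSum-Ferrers C a) (sym (sameRowSums a))) deficit≡0
deficit-shifts C (suc s) B sameRowSums deficit≡1+s
  with deficit-positive⇒hole (Ferrers C) B (subst (0 <_) (sym deficit≡1+s) (s≤s z≤n))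
... | a , b' , Fab'≡1 , Bab'≡0
  with equalRowSums⇒surplus (Ferrers C a) (B a) (trans (rowSum-Ferrers C a) (sym (sameRowSums a))) b' Fab'≡1 Bab'≡0
... | b , Fab≡0 , Bab≡1 =
  move B a b b' , move-shift B a b b' b'<b Bab≡1 Bab'≡0 ,
  deficit-shifts C s (move B a b b')
    (λ a' → trans (move-rowSum B a b b' (λ b≡b' → <⇒≢ᶠ b'<b (sym b≡b')) Bab≡1 Bab'≡0 a') (sameRowSums a'))
    (suc-injective (trans (sym (move-deficit B a b b' (Ferrers C) Fab≡0 Fab'≡1 Bab'≡0)) deficit≡1+s))
  where
    b'<b : b' <ᶠ b
    b'<b = Ferrers-true<false C Fab'≡1 Fab≡0

disc≡deficit : ∀ {m n} (B : Mat m n) → DiscIs B (deficit (Ferrers B) B)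
disc≡deficit B = deficit-shifts B _ B (λ _ → refl) refl , λ s → shifts-deficit s

deficit-permuted : ∀ {m n} (A B : Mat m n) (ρ : Permutation′ m) (τ : Permutation′ n) →
                   (∀ i j → B i j ≡ A (ρ ⟨$⟩ʳ i) (τ ⟨$⟩ʳ j)) →
                   deficit (Ferrers B) B ≡ deficit (Ferrers A) (colPerm A (flip τ))
deficit-permuted A B ρ τ B≡A = begin
  deficit (Ferrers B) B                                   ≡⟨ ∑-cong (λ a → ∑-cong (cell a)) ⟩
  ∑ (rowDeficit (Ferrers A) (colPerm A (flip τ)) ∘ (ρ ⟨$⟩ʳ_)) ≡⟨ ∑-permute _ ρ ⟩
  deficit (Ferrers A) (colPerm A (flip τ))                ∎
  where
    open ≡-Reasoning
    rowSum-B : ∀ a → rowSum B a ≡ rowSum A (ρ ⟨$⟩ʳ a)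
    rowSum-B a = trans (∑-cong λ b → cong val (B≡A a b)) (∑-permute (val ∘ A (ρ ⟨$⟩ʳ a)) τ)
    cell : ∀ a b → val (Ferrers B a b) ∸ val (B a b)
                 ≡ val (Ferrers A (ρ ⟨$⟩ʳ a) b) ∸ val (A (ρ ⟨$⟩ʳ a) (τ ⟨$⟩ʳ b))
    cell a b = cong₂ (λ f e → val f ∸ val e) (cong (λ r → does (toℕ b <? r)) (rowSum-B a)) (B≡A a b)

-- Column classes

if-cong : ∀ {P : Set} (d : Dec P) {y z : ℕ} → (P → y ≡ z) → (if does d then y else 0) ≡ (if does d then z else 0)
if-cong (yes p) y≡z = y≡z p
if-cong (no _)  _   = refl

classCost-cong : ∀ {m n} (A : Mat m n) y (σ τ : Permutation′ n) →
                 (∀ j → colSum A j ≡ y → σ ⟨$⟩ˡ j ≡ τ ⟨$⟩ˡ j) → classCost A y σ ≡ classCost A y τ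
classCost-cong A y σ τ agree = ∑-cong λ j → if-cong (colSum A j ≟ y)
  λ inClass → cong (λ j' → ∑ λ l → val (Ferrers A l j) ∸ val (A l j')) (agree j inClass)

PreservesClasses : ∀ {n} {C : Set} → (Fin n → C) → Permutation′ n → Set
PreservesClasses κ π = ∀ j → κ (π ⟨$⟩ʳ j) ≡ κ j

PreservesClasses-flip : ∀ {n} {C : Set} (κ : Fin n → C) π → PreservesClasses κ π → PreservesClasses κ (flip π)
PreservesClasses-flip κ π preserves j = trans (sym (preserves (π ⟨$⟩ˡ j))) (cong κ (inverseʳ π))

piecewise : ∀ {n} {C : Set} (κ : Fin n → C) (π : C → Permutation′ n) →
            (∀ i → PreservesClasses κ (π i)) → Permutation′ n
piecewise κ π preserves = permutation (λ j → π (κ j) ⟨$⟩ʳ j) (λ j → π (κ j) ⟨$⟩ˡ j) inverse₁ inverse₂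
  where
    inverse₁ : ∀ j → π (κ (π (κ j) ⟨$⟩ˡ j)) ⟨$⟩ʳ (π (κ j) ⟨$⟩ˡ j) ≡ j
    inverse₁ j = trans (cong (λ i → π i ⟨$⟩ʳ (π (κ j) ⟨$⟩ˡ j))
                             (PreservesClasses-flip κ (π (κ j)) (preserves (κ j)) j))
                       (inverseʳ (π (κ j)))
    inverse₂ : ∀ j → π (κ (π (κ j) ⟨$⟩ʳ j)) ⟨$⟩ˡ (π (κ j) ⟨$⟩ʳ j) ≡ j
    inverse₂ j = trans (cong (λ i → π i ⟨$⟩ˡ (π (κ j) ⟨$⟩ʳ j)) (preserves (κ j) j))
                       (inverseˡ (π (κ j)))

piecewise-preserves : ∀ {n} {C : Set} (κ : Fin n → C) π preserves → PreservesClasses κ (piecewise κ π preserves)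
piecewise-preserves κ π preserves j = preserves (κ j) j

onlyOn : ∀ {n k} → Fin k → Permutation′ n → Fin k → Permutation′ n
onlyOn i π i' with i' ≟ᶠ i
... | yes _ = π
... | no  _ = Perm.id

module _ {n k} (κ : Fin n → Fin k) (i : Fin k) (π : Permutation′ n) (preserves : PreservesClasses κ π) where

  restrict : Permutation′ n
  restrict = piecewise κ (onlyOn i π) onlyOn-preserves
    where
      onlyOn-preserves : ∀ i' → PreservesClasses κ (onlyOn i π i')
      onlyOn-preserves i' with i' ≟ᶠ i
      ... | yes _ = preserves
      ... | no  _ = λ _ → refl

  restrict-inside : ∀ {j} → κ j ≡ i → restrict ⟨$⟩ˡ j ≡ π ⟨$⟩ˡ j
  restrict-inside {j} κj≡i with κ j ≟ᶠ i
  ... | yes _    = refl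
  ... | no κj≢i = contradiction κj≡i κj≢i

  restrict-outside : ∀ {j} → κ j ≢ i → restrict ⟨$⟩ʳ j ≡ j
  restrict-outside {j} κj≢i with κ j ≟ᶠ i
  ... | yes κj≡i = contradiction κj≡i κj≢i
  ... | no _     = refl

strictlyDecreasing⇒injective : ∀ {k} {x : Fin k → ℕ} → (∀ i i' → i <ᶠ i' → x i > x i') →
                               ∀ {i i'} → x i ≡ x i' → i ≡ i'
strictlyDecreasing⇒injective decreasing {i} {i'} xi≡xi' with <-cmpᶠ i i'
... | tri< i<i' _ _ = contradiction (sym xi≡xi') (<⇒≢ (decreasing i i' i<i'))
... | tri≈ _ i≡i' _ = i≡i'
... | tri> _ _ i'<i = contradiction xi≡xi' (<⇒≢ (decreasing i' i i'<i))

module ColumnClasses {m n k} (A : Mat m n) (x : Fin k → ℕ) (x-injective : ∀ {i i'} → x i ≡ x i' → i ≡ i')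
                     (classOf : Fin n → Fin k) (colSum≡x : ∀ j → colSum A j ≡ x (classOf j)) where

  classOf-unique : ∀ {j i} → colSum A j ≡ x i → classOf j ≡ i
  classOf-unique {j} cj≡xi = x-injective (trans (sym (colSum≡x j)) cj≡xi)

  inClass⇔ : ∀ {j i} → colSum A j ≡ x i ⇔ classOf j ≡ i
  inClass⇔ {j} = mk⇔ classOf-unique λ { refl → colSum≡x j }

  ∑-overClasses : ∀ j y → ∑ (λ i → if does (colSum A j ≟ x i) then y else 0) ≡ y
  ∑-overClasses j y = trans
    (∑-cong λ i → cong (λ b → if b then y else 0) (does-⇔ inClass⇔ (colSum A j ≟ x i) (classOf j ≟ᶠ i)))
    (∑-indicator (classOf j) y)

  deficit≡∑classCost : ∀ σ → deficit (Ferrers A) (colPerm A σ) ≡ ∑ λ i → classCost A (x i) σ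
  deficit≡∑classCost σ = begin
    deficit F Aσ                  ≡⟨ ∑-comm (λ l j → val (F l j) ∸ val (Aσ l j)) ⟩
    ∑ (colDiff F Aσ)              ≡⟨ ∑-cong (λ j → sym (∑-overClasses j (colDiff F Aσ j))) ⟩
    ∑ (λ j → ∑ λ i → term j i)    ≡⟨ ∑-comm term ⟩
    ∑ (λ i → classCost A (x i) σ) ∎
    where
      open ≡-Reasoning
      F = Ferrers A
      Aσ = colPerm A σ
      term : Fin n → Fin k → ℕ
      term j i = if does (colSum A j ≟ x i) then colDiff F Aσ j else 0

  colSum-preserving⇒PreservesClasses : ∀ π → (∀ j → colSum A (π ⟨$⟩ʳ j) ≡ colSum A j) → PreservesClasses classOf π
  colSum-preserving⇒PreservesClasses π preserves j =
    x-injective (trans (sym (colSum≡x (π ⟨$⟩ʳ j))) (trans (preserves j) (colSum≡x j)))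

  PreservesClasses⇒colSum-preserving : ∀ π → PreservesClasses classOf π → ∀ j → colSum A (π ⟨$⟩ʳ j) ≡ colSum A j
  PreservesClasses⇒colSum-preserving π preserves j =
    trans (colSum≡x (π ⟨$⟩ʳ j)) (trans (cong x (preserves j)) (sym (colSum≡x j)))

  InSigma⇒PreservesClasses : ∀ i σ → InSigma A (x i) σ → PreservesClasses classOf σ
  InSigma⇒PreservesClasses i σ fixes j with classOf j ≟ᶠ i | classOf (σ ⟨$⟩ʳ j) ≟ᶠ i
  ... | yes κj≡i | yes κσj≡i = trans κσj≡i (sym κj≡i)
  ... | _        | no κσj≢i  = cong classOf (begin
    σ ⟨$⟩ʳ j                   ≡⟨ inverseˡ σ ⟨
    σ ⟨$⟩ˡ (σ ⟨$⟩ʳ (σ ⟨$⟩ʳ j)) ≡⟨ cong (σ ⟨$⟩ˡ_) (fixesOutside (σ ⟨$⟩ʳ j) κσj≢i) ⟩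
    σ ⟨$⟩ˡ (σ ⟨$⟩ʳ j)          ≡⟨ inverseˡ σ ⟩
    j                          ∎)
    where
      open ≡-Reasoning
      fixesOutside : ∀ j → classOf j ≢ i → σ ⟨$⟩ʳ j ≡ j
      fixesOutside j κj≢i = fixes j (κj≢i ∘ classOf-unique)
  ... | no κj≢i  | yes _     = cong classOf (fixes j (κj≢i ∘ classOf-unique))

  module Minimisers (v : Fin k → ℕ)
           (v-least : ∀ i → IsLeast (λ d → Σ (Permutation′ n) λ σ → InSigma A (x i) σ × classCost A (x i) σ ≡ d) (v i))
           where

    ∑v≤classCosts : ∀ σ → PreservesClasses classOf σ → ∑ v ≤ ∑ λ i → classCost A (x i) σ
    ∑v≤classCosts σ preserves = ∑-mono-≤ classwise
      where
        classwise : ∀ i → v i ≤ classCost A (x i) σ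
        classwise i = subst (v i ≤_) sameCost (proj₂ (v-least i) _ (σᵢ , σᵢ-InSigma , refl))
          where
            σᵢ = restrict classOf i σ preserves
            σᵢ-InSigma : InSigma A (x i) σᵢ
            σᵢ-InSigma j outside = restrict-outside classOf i σ preserves (outside ∘ Equivalence.from inClass⇔)
            sameCost : classCost A (x i) σᵢ ≡ classCost A (x i) σ
            sameCost = classCost-cong A (x i) σᵢ σ λ j inClass →
              restrict-inside classOf i σ preserves (classOf-unique inClass)

    ∑v≤deficit : ∀ {B} → InI A B → ∑ v ≤ deficit (Ferrers B) B
    ∑v≤deficit {B} (ρ , τ , _ , τ-preserves , B≡A) = begin
      ∑ v                                        ≤⟨ ∑v≤classCosts (flip τ) flipτ-preservesClasses ⟩
      ∑ (λ i → classCost A (x i) (flip τ))       ≡⟨ deficit≡∑classCost (flip τ) ⟨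
      deficit (Ferrers A) (colPerm A (flip τ))   ≡⟨ deficit-permuted A B ρ τ B≡A ⟨
      deficit (Ferrers B) B                      ∎
      where
        open ≤-Reasoning
        flipτ-preservesClasses = PreservesClasses-flip classOf τ (colSum-preserving⇒PreservesClasses τ τ-preserves)

    minimiser : Fin k → Permutation′ n
    minimiser i = proj₁ (proj₁ (v-least i))

    minimiser-preserves : ∀ i → PreservesClasses classOf (minimiser i)
    minimiser-preserves i = InSigma⇒PreservesClasses i (minimiser i) (proj₁ (proj₂ (proj₁ (v-least i))))

    glued : Permutation′ n
    glued = piecewise classOf minimiser minimiser-preserves

    glued-InI : InI A (colPerm A glued)
    glued-InI = Perm.id , flip glued , (λ _ → refl) ,
                PreservesClasses⇒colSum-preserving (flip glued)
                  (PreservesClasses-flip classOf glued (piecewise-preserves classOf minimiser minimiser-preserves)) ,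
                λ _ _ → refl

    glued-classCost : ∀ i → classCost A (x i) glued ≡ v i
    glued-classCost i = trans
      (classCost-cong A (x i) glued (minimiser i) λ j inClass →
        cong (λ i' → minimiser i' ⟨$⟩ˡ j) (classOf-unique inClass))
      (proj₂ (proj₂ (proj₁ (v-least i))))

    glued-deficit : deficit (Ferrers (colPerm A glued)) (colPerm A glued) ≡ ∑ v
    glued-deficit = begin
      deficit (Ferrers (colPerm A glued)) (colPerm A glued)
        ≡⟨ deficit-permuted A _ Perm.id (flip glued) (λ _ _ → refl) ⟩
      deficit (Ferrers A) (colPerm A glued)                 ≡⟨ deficit≡∑classCost glued ⟩
      ∑ (λ i → classCost A (x i) glued)                     ≡⟨ ∑-cong glued-classCost ⟩
      ∑ v                                                   ∎
      where open ≡-Reasoning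

proposition2 : ∀ {m n k} (A : Mat m n) (x : Fin k → ℕ) →
    NonIncreasing (rowSum A) →
    NonIncreasing (colSum A) →
    (∀ (i i' : Fin k) → i <ᶠ i' → x i > x i') →
    (∀ j → Σ (Fin k) λ i → colSum A j ≡ x i) →
    (∀ i → Σ (Fin n) λ j → colSum A j ≡ x i) →
    (v : Fin k → ℕ) →
    (∀ i → IsLeast (λ d → Σ (Permutation′ n) λ σ → InSigma A (x i) σ × classCost A (x i) σ ≡ d) (v i)) →
    IdIs A (∑ v)
proposition2 A x _ _ decreasing hasClass _ v v-least =
  (colPerm A glued , glued-InI , subst (DiscIs (colPerm A glued)) glued-deficit (disc≡deficit (colPerm A glued))) ,
  λ { d (B , B∈I , disc-B) → ≤-trans (∑v≤deficit B∈I) (shifts-deficit d (proj₁ disc-B)) }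
  where
    open ColumnClasses.Minimisers A x (strictlyDecreasing⇒injective decreasing)
                                  (proj₁ ∘ hasClass) (proj₂ ∘ hasClass) v v-least
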